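{- Let $m$ be an odd positive integer with $m\neq 3$. Then the rose window graph $R_{12m}(3m+2,9m+1)$ is a Cayley graph.
   Context: For integers $n\ge 3$ and $1\le a,r\le n-1$, the rose window graph $R_n(a,r)$ has vertex set $\{A_i,B_i : i\in\mathbb{Z}_n\}$ and edges $A_iA_{i+1}$, $A_iB_i$, $A_{i+a}B_i$ and $B_iB_{i+r}$, indices taken modulo $n$. A graph is Cayley iff its automorphism group has a subgroup acting regularly on its vertices. -}

module Defs where

open import Level using (0ℓ)
open import Data.Nat using (ℕ; _+_)
open import Data.Integer as ℤ using (ℤ; +_)
open import Data.Integer.Divisibility using (_∣_)
open import Data.Fin using (Fin; toℕ)
open import Data.Sum using (_⊎_)
open import Data.Empty using (⊥)
open import Data.Product using (Σ; ∃; _×_)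
open import Relation.Binary.PropositionalEquality using (_≡_)
open import Function using (id; _∘_)

record Graph : Set₁ where
  field
    V   : Set
    Adj : V → V → Set

_≡_[mod_] : ℕ → ℕ → ℕ → Set
x ≡ y [mod n ] = (+ n) ∣ ((+ x) ℤ.- (+ y))

data RVertex (n : ℕ) : Set where
  A : Fin n → RVertex n
  B : Fin n → RVertex n

REdge : (n a r : ℕ) → RVertex n → RVertex n → Set
REdge n a r (A i) (A j) = toℕ j ≡ toℕ i + 1 [mod n ]
REdge n a r (A i) (B j) = (toℕ i ≡ toℕ j [mod n ]) ⊎ (toℕ i ≡ toℕ j + a [mod n ])
REdge n a r (B i) (B j) = toℕ j ≡ toℕ i + r [mod n ]
REdge n a r (B i) (A j) = ⊥

RoseWindow : (n a r : ℕ) → Graph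
RoseWindow n a r = record
  { V   = RVertex n
  ; Adj = λ u v → REdge n a r u v ⊎ REdge n a r v u
  }

record Aut (G : Graph) : Set where
  open Graph G
  field
    to      : V → V
    from    : V → V
    to-from : ∀ v → to (from v) ≡ v
    from-to : ∀ v → from (to v) ≡ v
    pres    : ∀ u v → Adj u v → Adj (to u) (to v)
    refl'   : ∀ u v → Adj (to u) (to v) → Adj u v

open Aut public

module _ {G : Graph} where
  open Graph G

  idAut : Aut G
  idAut = record { to = id ; from = id ; to-from = λ _ → Relation.Binary.PropositionalEquality.refl
                 ; from-to = λ _ → Relation.Binary.PropositionalEquality.refl
                 ; pres = λ _ _ p → p ; refl' = λ _ _ p → p }

  _∘ᴬ_ : Aut G → Aut G → Aut G
  g ∘ᴬ h = record
    { to = to g ∘ to h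
    ; from = from h ∘ from g
    ; to-from = λ v → Relation.Binary.PropositionalEquality.trans
        (Relation.Binary.PropositionalEquality.cong (to g) (to-from h (from g v))) (to-from g v)
    ; from-to = λ v → Relation.Binary.PropositionalEquality.trans
        (Relation.Binary.PropositionalEquality.cong (from h) (from-to g (to h v))) (from-to h v)
    ; pres = λ u v p → pres g _ _ (pres h u v p)
    ; refl' = λ u v p → refl' h u v (refl' g _ _ p)
    }

  invAut : Aut G → Aut G
  invAut g = record
    { to = from g ; from = to g ; to-from = from-to g ; from-to = to-from g
    ; pres = λ u v p → refl' g _ _
        (Relation.Binary.PropositionalEquality.subst₂ Adj
          (Relation.Binary.PropositionalEquality.sym (to-from g u))
          (Relation.Binary.PropositionalEquality.sym (to-from g v)) p)
    ; refl' = λ u v p → Relation.Binary.PropositionalEquality.subst₂ Adj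
          (to-from g u) (to-from g v) (pres g _ _ p)
    }

record IsSubgroup (G : Graph) (P : Aut G → Set) : Set where
  field
    has-id  : P idAut
    has-∘   : ∀ g h → P g → P h → P (g ∘ᴬ h)
    has-inv : ∀ g → P g → P (invAut g)

record ActsRegularly (G : Graph) (P : Aut G → Set) : Set where
  open Graph G
  field
    transitive   : ∀ u v → Σ (Aut G) (λ g → P g × to g u ≡ v)
    semiregular  : ∀ g → P g → ∀ u → to g u ≡ u → ∀ w → to g w ≡ w

IsCayley : Graph → Set₁
IsCayley G = Σ (Aut G → Set) (λ P → IsSubgroup G P × ActsRegularly G P)

-- Write m = 2W + 1 and n = 12m. Let ρ be the rotation A_i ↦ A_{i+1}, B_i ↦ B_{i+1}. The regular
-- subgroup is generated by ρ² and one further automorphism σ (row (rim , 1) of the table below);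
-- every element of it moves the vertex (side, i) by a translation i ↦ i + c, where c and the new
-- side depend only on the side and on i mod 3. Powers of ρ⁶ preserve these six classes, hence
-- commute with all such maps, and modulo them the group has twelve elements, one for each block
-- (side, i mod 6) that A₀ can be sent to. Writing every translation amount as 6αW + β, closure
-- under composition and inverses, preservation of edges and freeness all become finitely many
-- statements about pairs (α , β), to hold up to multiples of (4 , 12), i.e. of 24W + 12 = n.
-- These are decided by computation. Stabilisers are trivial: an element outside ⟨ρ⁶⟩ changes the
-- side of every vertex or moves it by an amount not divisible by 6.

module Submission where

open import Defs
open import Data.Nat as ℕ using (ℕ; suc; NonZero)
import Data.Nat.Properties as ℕₚ
import Data.Nat.Divisibility as ℕ∣
open import Data.Nat.DivMod using (m<n⇒m%n≡m; m≡m%n+[m/n]*n)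
import Data.Nat.Tactic.RingSolver as ℕ-Ring
open import Data.Integer as ℤ using (ℤ; +_; _+_; _-_; _*_; -_; _/ℕ_)
import Data.Integer.Properties as ℤₚ
open import Data.Integer.DivMod using (n%ℕd<d; a≡a%ℕn+[a/ℕn]*n)
open import Data.Integer.Divisibility.Signed
  using (_∣_; _∣?_; divides; ∣-refl; ∣ᵤ⇒∣; ∣⇒∣ᵤ; ∣-trans; ∣m∣n⇒∣m+n; ∣m∣n⇒∣m-n; ∣m⇒∣-m; ∣n⇒∣m*n)
open import Data.Integer.Tactic.RingSolver using (solve-∀)
open import Data.Fin using (Fin; zero; suc; toℕ; fromℕ<)
import Data.Fin.Properties as Finₚ
open import Data.Vec using (Vec; _∷_; []; lookup)
open import Data.Product using (Σ; ∃; _×_; _,_; proj₁; proj₂; uncurry)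
open import Data.Product.Properties using (≡-dec)
open import Data.Product.Relation.Binary.Pointwise.NonDependent using (Pointwise; ×-isEquivalence)
open import Data.Sum using (_⊎_; inj₁; inj₂; [_,_]′)
open import Function using (_∘_)
open import Relation.Nullary using (Dec; yes; no; contradiction)
open import Relation.Nullary.Decidable using (from-yes; map′; _×-dec_; _⊎-dec_; _→-dec_)
open import Relation.Unary using (Pred; Decidable)
open import Relation.Binary using (DecidableEquality; IsEquivalence)
open import Relation.Binary.PropositionalEquality
  using (_≡_; _≢_; refl; sym; trans; cong; cong₂; subst; subst₂; isEquivalence; module ≡-Reasoning)

-- Regular actions by automorphisms

record RegularAction (G : Graph) : Set₁ where
  open Graph G
  infixl 7 _∙_
  infix 8 _⁻¹
  field
    Carrier  : Set
    ε        : Carrier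
    _∙_      : Carrier → Carrier → Carrier
    _⁻¹      : Carrier → Carrier
    act      : Carrier → V → V
    act-ε    : ∀ v → act ε v ≡ v
    act-∙    : ∀ x y v → act x (act y v) ≡ act (x ∙ y) v
    act-⁻¹   : ∀ x v → act (x ⁻¹) (act x v) ≡ v
    act-Adj  : ∀ x u v → Adj u v → Adj (act x u) (act x v)
    origin   : V
    reach    : V → Carrier
    act-reach : ∀ v → act (reach v) origin ≡ v
    free     : ∀ x u → act x u ≡ u → ∀ v → act x v ≡ v

  -- act (x ⁻¹) is injective, act (x ⁻¹ ⁻¹) being a left inverse of it.
  act-⁻¹ʳ : ∀ x v → act x (act (x ⁻¹) v) ≡ v
  act-⁻¹ʳ x v = begin
    act x (act (x ⁻¹) v)                                ≡⟨ act-⁻¹ (x ⁻¹) _ ⟨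
    act (x ⁻¹ ⁻¹) (act (x ⁻¹) (act x (act (x ⁻¹) v)))  ≡⟨ cong (act (x ⁻¹ ⁻¹)) (act-⁻¹ x (act (x ⁻¹) v)) ⟩
    act (x ⁻¹ ⁻¹) (act (x ⁻¹) v)                        ≡⟨ act-⁻¹ (x ⁻¹) v ⟩
    v                                                   ∎
    where open ≡-Reasoning

  transitive : ∀ u v → ∃ λ x → act x u ≡ v
  transitive u v = reach v ∙ reach u ⁻¹ , (begin
    act (reach v ∙ reach u ⁻¹) u                  ≡⟨ act-∙ (reach v) (reach u ⁻¹) u ⟨
    act (reach v) (act (reach u ⁻¹) u)            ≡⟨ cong (act (reach v) ∘ act (reach u ⁻¹)) (act-reach u) ⟨
    act (reach v) (act (reach u ⁻¹) (act (reach u) origin)) ≡⟨ cong (act (reach v)) (act-⁻¹ (reach u) origin) ⟩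
    act (reach v) origin                          ≡⟨ act-reach v ⟩
    v                                             ∎)
    where open ≡-Reasoning

  automorphism : Carrier → Aut G
  automorphism x = record
    { to      = act x
    ; from    = act (x ⁻¹)
    ; to-from = act-⁻¹ʳ x
    ; from-to = act-⁻¹ x
    ; pres    = act-Adj x
    ; refl'   = λ u v adj → subst₂ Adj (act-⁻¹ x u) (act-⁻¹ x v) (act-Adj (x ⁻¹) _ _ adj)
    }

regularAction⇒Cayley : ∀ {G} → RegularAction G → IsCayley G
regularAction⇒Cayley {G} α = Induced , isSubgroup , actsRegularly
  where
  open RegularAction α
  Induced : Aut G → Set
  Induced g = ∃ λ x → ∀ v → to g v ≡ act x v

  isSubgroup : IsSubgroup G Induced
  isSubgroup = record
    { has-id  = ε , λ v → sym (act-ε v)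
    ; has-∘   = λ { g h (x , g≗x) (y , h≗y) →
        x ∙ y , λ v → trans (cong (to g) (h≗y v)) (trans (g≗x _) (act-∙ x y v)) }
    ; has-inv = λ { g (x , g≗x) →
        x ⁻¹ , λ v → trans (cong (from g) (sym (trans (g≗x _) (act-⁻¹ʳ x v)))) (from-to g _) }
    }

  actsRegularly : ActsRegularly G Induced
  actsRegularly = record
    { transitive  = λ u v → let x , xu≡v = transitive u v in automorphism x , (x , λ _ → refl) , xu≡v
    ; semiregular = λ { g (x , g≗x) u gu≡u w →
        trans (g≗x w) (free x u (trans (sym (g≗x u)) gu≡u) w) }
    }

-- Residues and congruences of integers

∣∧<⇒≡0 : ∀ {k z} → k ℕ∣.∣ z → z ℕ.< k → z ≡ 0
∣∧<⇒≡0 {z = ℕ.zero}  _   _   = refl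
∣∧<⇒≡0 {z = suc _} k∣z z<k = contradiction k∣z (ℕ∣.>⇒∤ z<k)

∣∸∧<⇒≤ : ∀ {k x y} → k ℕ∣.∣ y ℕ.∸ x → y ℕ.< k → y ℕ.≤ x
∣∸∧<⇒≤ {x = x} {y} k∣y∸x y<k = ℕₚ.m∸n≡0⇒m≤n (∣∧<⇒≡0 k∣y∸x (ℕₚ.≤-<-trans (ℕₚ.m∸n≤m y x) y<k))

∣+x-+y∣≡y∸x : ∀ {x y} → x ℕ.≤ y → ℤ.∣ + x - + y ∣ ≡ y ℕ.∸ x
∣+x-+y∣≡y∸x {x} {y} x≤y = trans (cong ℤ.∣_∣ (ℤₚ.m-n≡m⊖n x y)) (ℤₚ.∣⊖∣-≤ x≤y)

residue-unique : ∀ {k a b} → a ℕ.< k → b ℕ.< k → + k ∣ + a - + b → a ≡ b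
residue-unique {k} {a} {b} a<k b<k k∣a-b with ℕₚ.≤-total a b | ∣⇒∣ᵤ k∣a-b
... | inj₁ a≤b | k∣∣a-b∣ = ℕₚ.≤-antisym a≤b (∣∸∧<⇒≤ (subst (k ℕ∣.∣_) (∣+x-+y∣≡y∸x a≤b) k∣∣a-b∣) b<k)
... | inj₂ b≤a | k∣∣a-b∣ = sym (ℕₚ.≤-antisym b≤a (∣∸∧<⇒≤ (subst (k ℕ∣.∣_)
                              (trans (ℤₚ.∣i-j∣≡∣j-i∣ (+ a) (+ b)) (∣+x-+y∣≡y∸x b≤a)) k∣∣a-b∣) a<k))

residue : (k : ℕ) .{{_ : NonZero k}} → ℤ → Fin k
residue k z = fromℕ< (n%ℕd<d z k)

module _ (k : ℕ) .{{_ : NonZero k}} where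

  residue-decomposition : ∀ z → z ≡ + toℕ (residue k z) + (z /ℕ k) * + k
  residue-decomposition z = trans (a≡a%ℕn+[a/ℕn]*n z k)
    (cong (λ r → + r + (z /ℕ k) * + k) (sym (Finₚ.toℕ-fromℕ< (n%ℕd<d z k))))

  residue-cong : ∀ {x y} → + k ∣ x - y → residue k x ≡ residue k y
  residue-cong {x} {y} k∣x-y =
    Finₚ.toℕ-injective (residue-unique (Finₚ.toℕ<n _) (Finₚ.toℕ<n _) k∣rx-ry)
    where
    rx = + toℕ (residue k x)
    ry = + toℕ (residue k y)
    qx = x /ℕ k
    qy = y /ℕ k
    cancel : ∀ rx ry qx qy K → ((rx + qx * K) - (ry + qy * K)) - (qx - qy) * K ≡ rx - ry
    cancel = solve-∀
    k∣rx-ry : + k ∣ rx - ry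
    k∣rx-ry = subst (+ k ∣_)
      (trans (cong₂ (λ a b → (a - b) - (qx - qy) * + k) (residue-decomposition x) (residue-decomposition y))
             (cancel rx ry qx qy (+ k)))
      (∣m∣n⇒∣m-n k∣x-y (∣n⇒∣m*n (qx - qy) ∣-refl))

  residue-∣ : ∀ z → + k ∣ z - + toℕ (residue k z)
  residue-∣ z = divides (z /ℕ k) (trans (cong (_- r) (residue-decomposition z)) (cancel r (z /ℕ k) (+ k)))
    where
    r = + toℕ (residue k z)
    cancel : ∀ r q K → (r + q * K) - r ≡ q * K
    cancel = solve-∀

  residue-+ʳ : ∀ z δ β → + k ∣ δ - β → residue k (z + δ) ≡ residue k (z + β)
  residue-+ʳ z δ β k∣δ-β = residue-cong {z + δ} {z + β} (subst (+ k ∣_) (shift z δ β) k∣δ-β)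
    where
    shift : ∀ z δ β → δ - β ≡ (z + δ) - (z + β)
    shift = solve-∀

  residue-absorbˡ : ∀ z β → residue k (z + β) ≡ residue k (+ toℕ (residue k z) + β)
  residue-absorbˡ z β = residue-cong {z + β} {r + β} (subst (+ k ∣_) (shift z r β) (residue-∣ z))
    where
    r = + toℕ (residue k z)
    shift : ∀ z r β → z - r ≡ (z + β) - (r + β)
    shift = solve-∀

  residue-toℕ : ∀ i → residue k (+ toℕ i) ≡ i
  residue-toℕ i = Finₚ.toℕ-injective (trans (Finₚ.toℕ-fromℕ< _) (m<n⇒m%n≡m (Finₚ.toℕ<n i)))

module Modular (n : ℕ) .{{_ : NonZero n}} where

  infix 4 _≈_
  record _≈_ (x y : ℤ) : Set where
    constructor congruent
    field n∣x-y : + n ∣ x - y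
  open _≈_ public

  ≈-by : ∀ {d x y} → + n ∣ d → d ≡ x - y → x ≈ y
  ≈-by n∣d refl = congruent n∣d

  ≈-refl : ∀ {x} → x ≈ x
  ≈-refl {x} = ≈-by (divides (+ 0) refl) (sym (ℤₚ.+-inverseʳ x))

  ≈-sym : ∀ {x y} → x ≈ y → y ≈ x
  ≈-sym {x} {y} (congruent n∣x-y) = ≈-by (∣m⇒∣-m n∣x-y) (negate x y)
    where
    negate : ∀ x y → - (x - y) ≡ y - x
    negate = solve-∀

  ≈-trans : ∀ {x y z} → x ≈ y → y ≈ z → x ≈ z
  ≈-trans {x} {y} {z} (congruent n∣x-y) (congruent n∣y-z) = ≈-by (∣m∣n⇒∣m+n n∣x-y n∣y-z) (telescope x y z)
    where
    telescope : ∀ x y z → (x - y) + (y - z) ≡ x - z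
    telescope = solve-∀

  ≈-isEquivalence : IsEquivalence _≈_
  ≈-isEquivalence = record { refl = ≈-refl ; sym = ≈-sym ; trans = ≈-trans }

  ≈-+ʳ : ∀ {x y} c → x ≈ y → x + c ≈ y + c
  ≈-+ʳ {x} {y} c (congruent n∣x-y) = ≈-by n∣x-y (shift x y c)
    where
    shift : ∀ x y c → x - y ≡ (x + c) - (y + c)
    shift = solve-∀

  ≈-+ˡ : ∀ z {x y} → x ≈ y → z + x ≈ z + y
  ≈-+ˡ z {x} {y} (congruent n∣x-y) = ≈-by n∣x-y (shift z x y)
    where
    shift : ∀ z x y → x - y ≡ (z + x) - (z + y)
    shift = solve-∀

  ≈-transpose : ∀ {x y c} → x ≈ y + c → y ≈ x + - c
  ≈-transpose {x} {y} {c} (congruent n∣) = ≈-by (∣m⇒∣-m n∣) (transpose x y c)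
    where
    transpose : ∀ x y c → - (x - (y + c)) ≡ y - (x + - c)
    transpose = solve-∀

  ≈-transpose⁻¹ : ∀ {x y c} → y ≈ x + - c → x ≈ y + c
  ≈-transpose⁻¹ {x} {y} {c} y≈x-c = subst (x ≈_) (cong (λ d → y + d) (ℤₚ.neg-involutive c)) (≈-transpose y≈x-c)

  private
    difference : ∀ z d → d ≡ (z + d) - z
    difference = solve-∀

  ≈-translate : ∀ {z d} → + n ∣ d → z + d ≈ z
  ≈-translate {z} {d} n∣d = ≈-by n∣d (difference z d)

  ≈-translate⁻¹ : ∀ {z d} → z + d ≈ z → + n ∣ d
  ≈-translate⁻¹ {z} {d} (congruent n∣) = subst (+ n ∣_) (sym (difference z d)) n∣

  ≈⇒∣ : ∀ {k x y} → + k ∣ + n → x ≈ y → + k ∣ x - y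
  ≈⇒∣ k∣n = ∣-trans k∣n ∘ n∣x-y

  residue-≈ : ∀ z → + toℕ (residue n z) ≈ z
  residue-≈ z = ≈-sym (congruent (residue-∣ n z))

  ≈⇒residue≡ : ∀ {x y} → x ≈ y → residue n x ≡ residue n y
  ≈⇒residue≡ {x} {y} x≈y = residue-cong n {x} {y} (n∣x-y x≈y)

  [mod]⇒≈ : ∀ x y c {d} → + c ≡ d → x ≡ y ℕ.+ c [mod n ] → + x ≈ + y + d
  [mod]⇒≈ _ _ _ refl = congruent ∘ ∣ᵤ⇒∣

  [mod]⇒≈⁻ : ∀ x y c {d} → - + c ≡ d → x ≡ y ℕ.+ c [mod n ] → + y ≈ + x + d
  [mod]⇒≈⁻ x y c refl = ≈-transpose {+ x} {+ y} {+ c} ∘ congruent ∘ ∣ᵤ⇒∣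

  ≈⇒[mod] : ∀ x y c {d} → + c ≡ d → + x ≈ + y + d → x ≡ y ℕ.+ c [mod n ]
  ≈⇒[mod] _ _ _ refl = ∣⇒∣ᵤ ∘ n∣x-y

  ≈⇒[mod]⁻ : ∀ x y c {d} → - + c ≡ d → + y ≈ + x + d → x ≡ y ℕ.+ c [mod n ]
  ≈⇒[mod]⁻ x y c refl = ∣⇒∣ᵤ ∘ n∣x-y ∘ ≈-transpose⁻¹ {+ x} {+ y} {+ c}

  [mod]-+0 : ∀ x y → x ≡ y [mod n ] → x ≡ y ℕ.+ 0 [mod n ]
  [mod]-+0 x y = subst (λ z → x ≡ z [mod n ]) (sym (ℕₚ.+-identityʳ y))

  [mod]-+0⁻¹ : ∀ x y → x ≡ y ℕ.+ 0 [mod n ] → x ≡ y [mod n ]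
  [mod]-+0⁻¹ x y = subst (λ z → x ≡ z [mod n ]) (ℕₚ.+-identityʳ y)

-- Class-wise translations

data Side : Set where
  rim hub : Side

_≟ˢ_ : DecidableEquality Side
rim ≟ˢ rim = yes refl
rim ≟ˢ hub = no λ ()
hub ≟ˢ rim = no λ ()
hub ≟ˢ hub = yes refl

∀-Side? : ∀ {ℓ} {P : Pred Side ℓ} → Decidable P → Dec (∀ t → P t)
∀-Side? P? = map′ (λ { (p , q) rim → p ; (p , q) hub → q }) (λ f → f rim , f hub) (P? rim ×-dec P? hub)

∀-Side×Fin? : ∀ {k ℓ} {P : Pred (Side × Fin k) ℓ} → Decidable P → Dec (∀ c → P c)
∀-Side×Fin? P? = map′ uncurry (λ f t i → f (t , i)) (∀-Side? λ t → Finₚ.all? λ i → P? (t , i))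

∃-Side×Fin? : ∀ {k ℓ} {P : Pred (Side × Fin k) ℓ} → Decidable P → Dec (∃ P)
∃-Side×Fin? P? = map′ (λ { (inj₁ (i , p)) → (rim , i) , p ; (inj₂ (i , p)) → (hub , i) , p })
                      (λ { ((rim , i) , p) → inj₁ (i , p) ; ((hub , i) , p) → inj₂ (i , p) })
                      (Finₚ.any? (λ i → P? (rim , i)) ⊎-dec Finₚ.any? (λ i → P? (hub , i)))

Class : Set
Class = Side × Fin 3

Block : Set
Block = Side × Fin 6

_≟ᵇ_ : DecidableEquality Block
_≟ᵇ_ = ≡-dec _≟ˢ_ Finₚ._≟_

-- (α , β) stands for the amount 6αW + β, and sixfold (α , β) for 6(αW + β), where m = 2W + 1.
Offset : Set
Offset = ℤ × ℤ

infixl 6 _⊕_ _⊖_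
infix 8 ⊝_

_⊕_ : Offset → Offset → Offset
(α , β) ⊕ (α′ , β′) = α + α′ , β + β′

_⊖_ : Offset → Offset → Offset
(α , β) ⊖ (α′ , β′) = α - α′ , β - β′

⊝_ : Offset → Offset
⊝ (α , β) = - α , - β

sixfold : Offset → Offset
sixfold (α , β) = α , + 6 * β

-- The offsets t(4 , 12), standing for the multiples of n = 24W + 12.
Period : Offset → Set
Period (α , β) = + 4 ∣ α × β ≡ + 3 * α

period? : Decidable Period
period? (α , β) = (+ 4 ∣? α) ×-dec (β ℤ.≟ + 3 * α)

record Move : Set where
  constructor _↦_
  field
    side   : Side
    offset : Offset
open Move

_≟ᵐ_ : DecidableEquality Move
(s ↦ o) ≟ᵐ (s′ ↦ o′) = map′ (uncurry (cong₂ _↦_)) (λ eq → cong side eq , cong offset eq)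
                             ((s ≟ˢ s′) ×-dec ≡-dec ℤ._≟_ ℤ._≟_ o o′)

infix 4 _≃_
_≃_ : Move → Move → Set
μ ≃ ν = side μ ≡ side ν × Period (offset μ ⊖ offset ν)

_≃?_ : ∀ μ ν → Dec (μ ≃ ν)
μ ≃? ν = (side μ ≟ˢ side ν) ×-dec period? (offset μ ⊖ offset ν)

ClassMap : Set
ClassMap = Class → Move

next : Fin 3 → ℤ → Fin 3
next ρ β = residue 3 (+ toℕ ρ + β)

target : ClassMap → Class → Class
target f (t , ρ) = side (f (t , ρ)) , next ρ (proj₂ (offset (f (t , ρ))))

infixr 9 _⊙_
_⊙_ : ClassMap → ClassMap → ClassMap
(f ⊙ g) c = side (f (target g c)) ↦ (offset (g c) ⊕ offset (f (target g c)))

translate : Offset → ClassMap → ClassMap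
translate o f c = side (f c) ↦ (offset (f c) ⊕ o)

-- A dart d leads from position i to i + ⟦ step d ⟧ (see below) along an edge of R_n(a , r).
data Dart : Side → Side → Set where
  AA⁺ AA⁻ : Dart rim rim
  AB AB⁻  : Dart rim hub
  BA BA⁺  : Dart hub rim
  BB⁺ BB⁻ : Dart hub hub

step : ∀ {s t} → Dart s t → Offset
step AA⁺ = + 0 , + 1
step AA⁻ = ⊝ step AA⁺
step AB  = + 0 , + 0
step AB⁻ = ⊝ step BA⁺
step BA  = + 0 , + 0
step BA⁺ = + 1 , + 5
step BB⁺ = + 3 , + 10
step BB⁻ = ⊝ step BB⁺

∀-Dart? : ∀ {ℓ} {P : ∀ {s t} → Dart s t → Set ℓ} →
          (∀ {s t} (d : Dart s t) → Dec (P d)) → Dec (∀ {s t} (d : Dart s t) → P d)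
∀-Dart? P? = map′
  (λ { (p₁ , p₂ , p₃ , p₄ , p₅ , p₆ , p₇ , p₈) →
       λ { AA⁺ → p₁ ; AA⁻ → p₂ ; AB → p₃ ; AB⁻ → p₄ ; BA → p₅ ; BA⁺ → p₆ ; BB⁺ → p₇ ; BB⁻ → p₈ } })
  (λ f → f AA⁺ , f AA⁻ , f AB , f AB⁻ , f BA , f BA⁺ , f BB⁺ , f BB⁻)
  (P? AA⁺ ×-dec P? AA⁻ ×-dec P? AB ×-dec P? AB⁻ ×-dec P? BA ×-dec P? BA⁺ ×-dec P? BB⁺ ×-dec P? BB⁻)

∃-Dart? : ∀ {ℓ} s t {P : Pred (Dart s t) ℓ} → Decidable P → Dec (∃ P)
∃-Dart? s t {P} P? = map′ [ (_ ,_) , (_ ,_) ]′ choose (P? (first s t) ⊎-dec P? (second s t))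
  where
  first second : ∀ s t → Dart s t
  first rim rim  = AA⁺
  first rim hub  = AB
  first hub rim  = BA
  first hub hub  = BB⁺
  second rim rim = AA⁻
  second rim hub = AB⁻
  second hub rim = BA⁺
  second hub hub = BB⁻
  choose : ∃ P → P (first s t) ⊎ P (second s t)
  choose (AA⁺ , p) = inj₁ p
  choose (AA⁻ , p) = inj₂ p
  choose (AB  , p) = inj₁ p
  choose (AB⁻ , p) = inj₂ p
  choose (BA  , p) = inj₁ p
  choose (BA⁺ , p) = inj₂ p
  choose (BB⁺ , p) = inj₁ p
  choose (BB⁻ , p) = inj₂ p

rim⟨_,_⟩ hub⟨_,_⟩ : ℕ → ℕ → Move
rim⟨ α , β ⟩ = rim ↦ (+ α , + β)
hub⟨ α , β ⟩ = hub ↦ (+ α , + β)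

record Row : Set where
  constructor row
  field rim₀ rim₁ rim₂ hub₀ hub₁ hub₂ : Move

_at_ : Row → ClassMap
r at (rim , zero)           = Row.rim₀ r
r at (rim , suc zero)       = Row.rim₁ r
r at (rim , suc (suc zero)) = Row.rim₂ r
r at (hub , zero)           = Row.hub₀ r
r at (hub , suc zero)       = Row.hub₁ r
r at (hub , suc (suc zero)) = Row.hub₂ r

base : Class
base = rim , zero

identity : Block
identity = rim , zero

-- Kept abstract, so that outside this block only the facts checked below are used;
-- unfolding the table elsewhere makes type checking very slow.
abstract
  -- Row (t , i): the element sending A₀ to (t , i), up to a power of ρ⁶.
  rows : Side → Vec Row 6
  rows rim =
    row rim⟨ 0 , 0 ⟩ rim⟨ 0 , 0 ⟩ rim⟨ 0 , 0 ⟩ hub⟨ 0 , 0 ⟩ hub⟨ 0 , 0 ⟩ hub⟨ 0 , 0 ⟩ ∷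
    row rim⟨ 0 , 1 ⟩ hub⟨ 0 , 0 ⟩ hub⟨ 3 , 9 ⟩ rim⟨ 0 , 2 ⟩ rim⟨ 1 , 5 ⟩ hub⟨ 2 , 7 ⟩ ∷
    row rim⟨ 0 , 2 ⟩ rim⟨ 0 , 2 ⟩ rim⟨ 0 , 2 ⟩ hub⟨ 0 , 2 ⟩ hub⟨ 0 , 2 ⟩ hub⟨ 0 , 2 ⟩ ∷
    row rim⟨ 0 , 3 ⟩ hub⟨ 0 , 2 ⟩ hub⟨ 3 , 11 ⟩ rim⟨ 0 , 4 ⟩ rim⟨ 1 , 7 ⟩ hub⟨ 2 , 9 ⟩ ∷
    row rim⟨ 0 , 4 ⟩ rim⟨ 0 , 4 ⟩ rim⟨ 0 , 4 ⟩ hub⟨ 0 , 4 ⟩ hub⟨ 0 , 4 ⟩ hub⟨ 0 , 4 ⟩ ∷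
    row rim⟨ 0 , 5 ⟩ hub⟨ 0 , 4 ⟩ hub⟨ 3 , 13 ⟩ rim⟨ 0 , 6 ⟩ rim⟨ 1 , 9 ⟩ hub⟨ 2 , 11 ⟩ ∷ []
  rows hub =
    row hub⟨ 0 , 0 ⟩ hub⟨ 3 , 9 ⟩ rim⟨ 0 , 1 ⟩ rim⟨ 1 , 5 ⟩ hub⟨ 2 , 7 ⟩ rim⟨ 0 , 2 ⟩ ∷
    row hub⟨ 0 , 1 ⟩ rim⟨ 1 , 5 ⟩ hub⟨ 1 , 4 ⟩ hub⟨ 3 , 11 ⟩ rim⟨ 1 , 6 ⟩ rim⟨ 2 , 9 ⟩ ∷
    row hub⟨ 0 , 2 ⟩ hub⟨ 3 , 11 ⟩ rim⟨ 0 , 3 ⟩ rim⟨ 1 , 7 ⟩ hub⟨ 2 , 9 ⟩ rim⟨ 0 , 4 ⟩ ∷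
    row hub⟨ 0 , 3 ⟩ rim⟨ 1 , 7 ⟩ hub⟨ 1 , 6 ⟩ hub⟨ 3 , 13 ⟩ rim⟨ 1 , 8 ⟩ rim⟨ 2 , 11 ⟩ ∷
    row hub⟨ 0 , 4 ⟩ hub⟨ 3 , 13 ⟩ rim⟨ 0 , 5 ⟩ rim⟨ 1 , 9 ⟩ hub⟨ 2 , 11 ⟩ rim⟨ 0 , 6 ⟩ ∷
    row hub⟨ 0 , 5 ⟩ rim⟨ 1 , 9 ⟩ hub⟨ 1 , 8 ⟩ hub⟨ 3 , 15 ⟩ rim⟨ 1 , 10 ⟩ rim⟨ 2 , 13 ⟩ ∷ []

  table : Block → ClassMap
  table (t , i) = lookup (rows t) i at_

  composite : Block → Block → Move
  composite b b′ = (table b ⊙ table b′) base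

  -- The product block and the remaining power of ρ⁶ are read off where the composite sends A₀.
  infixl 7 _·_
  _·_ : Block → Block → Block
  b · b′ = side (composite b b′) , residue 6 (proj₂ (offset (composite b b′)))

  correction : Block → Block → Offset
  correction b b′ = proj₁ (offset (composite b b′)) , proj₂ (offset (composite b b′)) /ℕ 6

MapsDart : Block → ∀ {s t} → Dart s t → Fin 3 → Set
MapsDart b {s} {t} d ρ =
  ∃ λ (d′ : Dart (side (table b (s , ρ))) (side (table b (t , ρ′)))) →
    Period (step d ⊕ offset (table b (t , ρ′)) ⊖ offset (table b (s , ρ)) ⊖ step d′)
  where ρ′ = next ρ (proj₂ (step d))

abstract
  table-base : ∀ b → table b base ≡ proj₁ b ↦ (+ 0 , + toℕ (proj₂ b))
  table-base = from-yes (∀-Side×Fin? λ b → table b base ≟ᵐ (proj₁ b ↦ (+ 0 , + toℕ (proj₂ b))))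

  table-identity : ∀ c → table identity c ≡ proj₁ c ↦ (+ 0 , + 0)
  table-identity = from-yes (∀-Side×Fin? λ c → table identity c ≟ᵐ (proj₁ c ↦ (+ 0 , + 0)))

  table-⊙ : ∀ b b′ c → (table b ⊙ table b′) c ≃ translate (sixfold (correction b b′)) (table (b · b′)) c
  table-⊙ = from-yes (∀-Side×Fin? λ b → ∀-Side×Fin? λ b′ → ∀-Side×Fin? λ c →
    (table b ⊙ table b′) c ≃? translate (sixfold (correction b b′)) (table (b · b′)) c)

  table-inverse : ∀ b → ∃ λ b′ → b′ · b ≡ identity
  table-inverse = from-yes (∀-Side×Fin? λ b → ∃-Side×Fin? λ b′ → (b′ · b) ≟ᵇ identity)

  table-free : ∀ b c → side (table b c) ≡ proj₁ c → + 6 ∣ proj₂ (offset (table b c)) → b ≡ identity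
  table-free = from-yes (∀-Side×Fin? λ b → ∀-Side×Fin? λ c →
    (side (table b c) ≟ˢ proj₁ c) →-dec (+ 6 ∣? proj₂ (offset (table b c))) →-dec (b ≟ᵇ identity))

  table-dart : ∀ b {s t} (d : Dart s t) ρ → MapsDart b d ρ
  table-dart = from-yes (∀-Side×Fin? λ b → ∀-Dart? λ d → Finₚ.all? λ ρ → mapsDart? b d ρ)
    where
    mapsDart? : ∀ b {s t} (d : Dart s t) ρ → Dec (MapsDart b d ρ)
    mapsDart? b d ρ = ∃-Dart? _ _ λ _ → period? _

-- (b , κ) acts as table b followed by ρ^(6(κ₁W + κ₂)); powers of ρ⁶ preserve every class.
Element : Set
Element = Block × Offset

classMap : Element → ClassMap
classMap (b , κ) = translate (sixfold κ) (table b)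

ε : Element
ε = identity , (+ 0 , + 0)

infixl 7 _∙_
_∙_ : Element → Element → Element
(b , κ) ∙ (b′ , κ′) = b · b′ , κ ⊕ κ′ ⊕ correction b b′

inverse : Block → Block
inverse b = proj₁ (table-inverse b)

infix 8 _⁻¹
_⁻¹ : Element → Element
(b , κ) ⁻¹ = inverse b , ⊝ (κ ⊕ correction (inverse b) b)

next-sixfold : ∀ ρ β γ → next ρ (β + + 6 * γ) ≡ next ρ β
next-sixfold ρ β γ = residue-+ʳ 3 (+ toℕ ρ) (β + + 6 * γ) β (divides (+ 2 * γ) (difference β γ))
  where
  difference : ∀ β γ → (β + + 6 * γ) - β ≡ (+ 2 * γ) * + 3
  difference = solve-∀

target-translate-sixfold : ∀ κ f c → target (translate (sixfold κ) f) c ≡ target f c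
target-translate-sixfold κ f (t , ρ) = cong (side (f (t , ρ)) ,_) (next-sixfold ρ (proj₂ (offset (f (t , ρ)))) (proj₂ κ))

regroup : ∀ o′ o o″ κ κ′ J →
  (o′ ⊕ o) ⊖ (o″ ⊕ sixfold J) ≡ ((o′ ⊕ sixfold κ′) ⊕ (o ⊕ sixfold κ)) ⊖ (o″ ⊕ sixfold (κ ⊕ κ′ ⊕ J))
regroup (α′ , β′) (α , β) (α″ , β″) (κ₁ , κ₂) (κ₁′ , κ₂′) (J₁ , J₂) =
  cong₂ _,_ (first α′ α α″ κ₁ κ₁′ J₁) (second β′ β β″ κ₂ κ₂′ J₂)
  where
  first : ∀ α′ α α″ κ₁ κ₁′ J₁ → (α′ + α) - (α″ + J₁) ≡ ((α′ + κ₁′) + (α + κ₁)) - (α″ + ((κ₁ + κ₁′) + J₁))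
  first = solve-∀
  second : ∀ β′ β β″ κ₂ κ₂′ J₂ →
    (β′ + β) - (β″ + + 6 * J₂) ≡ ((β′ + + 6 * κ₂′) + (β + + 6 * κ₂)) - (β″ + + 6 * ((κ₂ + κ₂′) + J₂))
  second = solve-∀

⊙-classMap : ∀ b κ b′ κ′ c → (classMap (b , κ) ⊙ classMap (b′ , κ′)) c ≡
  side (table b (target (table b′) c)) ↦
    ((offset (table b′ c) ⊕ sixfold κ′) ⊕ (offset (table b (target (table b′) c)) ⊕ sixfold κ))
⊙-classMap b κ b′ κ′ c = cong composed (target-translate-sixfold κ′ (table b′) c)
  where
  composed : Class → Move
  composed c₁ = side (table b c₁) ↦ ((offset (table b′ c) ⊕ sixfold κ′) ⊕ (offset (table b c₁) ⊕ sixfold κ))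

classMap-∙ : ∀ x y c → (classMap x ⊙ classMap y) c ≃ classMap (x ∙ y) c
classMap-∙ (b , κ) (b′ , κ′) c =
  subst (_≃ classMap ((b , κ) ∙ (b′ , κ′)) c) (sym (⊙-classMap b κ b′ κ′ c))
    (same-side , subst Period (regroup o′ o o″ κ κ′ (correction b b′)) period)
  where
  o′ = offset (table b′ c)
  o  = offset (table b (target (table b′) c))
  o″ = offset (table (b · b′) c)
  same-side = proj₁ (table-⊙ b b′ c)
  period    = proj₂ (table-⊙ b b′ c)

-- The action on R_{12m}(3m + 2 , 9m + 1), m = 2W + 1

module R₁₂ₘ (W : ℕ) where

  m : ℕ
  m = suc (2 ℕ.* W)

  n : ℕ
  n = 12 ℕ.* m

  instance
    n-nonZero : NonZero n
    n-nonZero = _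

  open Modular n

  a r : ℕ
  a = 3 ℕ.* m ℕ.+ 2
  r = 9 ℕ.* m ℕ.+ 1

  Γ : Graph
  Γ = RoseWindow n a r

  ⟦_⟧ : Offset → ℤ
  ⟦ α , β ⟧ = + 6 * α * + W + β

  ⟦⟧-⊕ : ∀ o o′ → ⟦ o ⊕ o′ ⟧ ≡ ⟦ o ⟧ + ⟦ o′ ⟧
  ⟦⟧-⊕ (α , β) (α′ , β′) = linear α β α′ β′ (+ W)
    where
    linear : ∀ α β α′ β′ w → + 6 * (α + α′) * w + (β + β′) ≡ (+ 6 * α * w + β) + (+ 6 * α′ * w + β′)
    linear = solve-∀

  ⟦⟧-⊖ : ∀ o o′ → ⟦ o ⊖ o′ ⟧ ≡ ⟦ o ⟧ - ⟦ o′ ⟧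
  ⟦⟧-⊖ (α , β) (α′ , β′) = linear α β α′ β′ (+ W)
    where
    linear : ∀ α β α′ β′ w → + 6 * (α - α′) * w + (β - β′) ≡ (+ 6 * α * w + β) - (+ 6 * α′ * w + β′)
    linear = solve-∀

  ⟦⟧-⊝ : ∀ o → ⟦ ⊝ o ⟧ ≡ - ⟦ o ⟧
  ⟦⟧-⊝ (α , β) = linear α β (+ W)
    where
    linear : ∀ α β w → + 6 * (- α) * w + (- β) ≡ - (+ 6 * α * w + β)
    linear = solve-∀

  ⟦⟧-mod-3 : ∀ α β → + 3 ∣ ⟦ α , β ⟧ - β
  ⟦⟧-mod-3 α β = divides (+ 2 * α * + W) (difference α β (+ W))
    where
    difference : ∀ α β w → (+ 6 * α * w + β) - β ≡ (+ 2 * α * w) * + 3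
    difference = solve-∀

  pos-affine : ∀ {k} c d → k ≡ c ℕ.* W ℕ.+ d → + k ≡ + c * + W + + d
  pos-affine c d refl = cong (λ z → z + + d) (ℤₚ.pos-* c W)

  n≡⟦4,12⟧ : + n ≡ ⟦ + 4 , + 12 ⟧
  n≡⟦4,12⟧ = pos-affine 24 12 (expand W)
    where
    expand : ∀ w → 12 ℕ.* suc (2 ℕ.* w) ≡ 24 ℕ.* w ℕ.+ 12
    expand = ℕ-Ring.solve-∀

  a≡⟦BA⁺⟧ : + a ≡ ⟦ step BA⁺ ⟧
  a≡⟦BA⁺⟧ = pos-affine 6 5 (expand W)
    where
    expand : ∀ w → 3 ℕ.* suc (2 ℕ.* w) ℕ.+ 2 ≡ 6 ℕ.* w ℕ.+ 5
    expand = ℕ-Ring.solve-∀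

  r≡⟦BB⁺⟧ : + r ≡ ⟦ step BB⁺ ⟧
  r≡⟦BB⁺⟧ = pos-affine 18 10 (expand W)
    where
    expand : ∀ w → 9 ℕ.* suc (2 ℕ.* w) ℕ.+ 1 ≡ 18 ℕ.* w ℕ.+ 10
    expand = ℕ-Ring.solve-∀

  period⇒∣ : ∀ o → Period o → + n ∣ ⟦ o ⟧
  period⇒∣ (.(q * + 4) , .(+ 3 * (q * + 4))) (divides q refl , refl) =
    divides q (trans (factor q (+ W)) (cong (q *_) (sym n≡⟦4,12⟧)))
    where
    factor : ∀ q w → + 6 * (q * + 4) * w + + 3 * (q * + 4) ≡ q * (+ 24 * w + + 12)
    factor = solve-∀

  3∣n : + 3 ∣ + n
  3∣n = ∣ᵤ⇒∣ (ℕ∣.∣-trans (ℕ∣.divides 4 refl) (ℕ∣.m∣m*n m))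

  6∣n : + 6 ∣ + n
  6∣n = ∣ᵤ⇒∣ (ℕ∣.∣-trans (ℕ∣.divides 2 refl) (ℕ∣.m∣m*n m))

  Point : Set
  Point = Side × ℤ

  infix 4 _~_
  _~_ : Point → Point → Set
  _~_ = Pointwise _≡_ _≈_

  open IsEquivalence (×-isEquivalence {R = _≡_ {A = Side}} isEquivalence ≈-isEquivalence)
    using () renaming (refl to ~-refl; sym to ~-sym; trans to ~-trans)

  classOf : Point → Class
  classOf (t , z) = t , residue 3 z

  apply : ClassMap → Point → Point
  apply f p = side (f (classOf p)) , proj₂ p + ⟦ offset (f (classOf p)) ⟧

  residue-shift : ∀ z α β → residue 3 (z + ⟦ α , β ⟧) ≡ next (residue 3 z) β
  residue-shift z α β = trans (residue-+ʳ 3 z ⟦ α , β ⟧ β (⟦⟧-mod-3 α β)) (residue-absorbˡ 3 z β)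

  classOf-cong : ∀ {p q} → p ~ q → classOf p ≡ classOf q
  classOf-cong {t , x} {.t , y} (refl , x≈y) = cong (t ,_) (residue-cong 3 {x} {y} (≈⇒∣ 3∣n x≈y))

  classOf-apply : ∀ f p → classOf (apply f p) ≡ target f (classOf p)
  classOf-apply f (t , z) = cong (side μ ,_) (residue-shift z (proj₁ (offset μ)) (proj₂ (offset μ)))
    where μ = f (t , residue 3 z)

  apply-⊙ : ∀ f g p → apply f (apply g p) ≡ apply (f ⊙ g) p
  apply-⊙ f g p@(t , z) = begin
    side (f (classOf q)) , (z + ⟦ o ⟧) + ⟦ offset (f (classOf q)) ⟧
      ≡⟨ cong (λ c → side (f c) , (z + ⟦ o ⟧) + ⟦ offset (f c) ⟧) (classOf-apply g p) ⟩
    side (f c′) , (z + ⟦ o ⟧) + ⟦ o′ ⟧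
      ≡⟨ cong (side (f c′) ,_) (trans (ℤₚ.+-assoc z ⟦ o ⟧ ⟦ o′ ⟧) (cong (λ d → z + d) (sym (⟦⟧-⊕ o o′)))) ⟩
    side (f c′) , z + ⟦ o ⊕ o′ ⟧ ∎
    where
    open ≡-Reasoning
    q  = apply g p
    o  = offset (g (classOf p))
    c′ = target g (classOf p)
    o′ = offset (f c′)

  apply-cong : ∀ f {p q} → p ~ q → apply f p ~ apply f q
  apply-cong f {p@(t , x)} {q@(.t , y)} p~q@(refl , x≈y) =
    cong (side ∘ f) (classOf-cong p~q) ,
    subst (λ c → x + ⟦ offset (f (classOf p)) ⟧ ≈ y + ⟦ offset (f c) ⟧) (classOf-cong p~q) (≈-+ʳ _ x≈y)

  apply-≃ : ∀ f g p → f (classOf p) ≃ g (classOf p) → apply f p ~ apply g p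
  apply-≃ f g (t , z) (same-side , period) =
    same-side , ≈-+ˡ z (congruent (subst (+ n ∣_) (⟦⟧-⊖ (offset μ) (offset ν)) (period⇒∣ _ period)))
    where
    μ = f (t , residue 3 z)
    ν = g (t , residue 3 z)

  vertex : Point → RVertex n
  vertex (rim , z) = A (residue n z)
  vertex (hub , z) = B (residue n z)

  point : RVertex n → Point
  point (A i) = rim , + toℕ i
  point (B i) = hub , + toℕ i

  vertex-cong : ∀ {p q} → p ~ q → vertex p ≡ vertex q
  vertex-cong {rim , x} {.rim , y} (refl , x≈y) = cong A (≈⇒residue≡ x≈y)
  vertex-cong {hub , x} {.hub , y} (refl , x≈y) = cong B (≈⇒residue≡ x≈y)

  point-vertex : ∀ p → point (vertex p) ~ p
  point-vertex (rim , z) = refl , residue-≈ z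
  point-vertex (hub , z) = refl , residue-≈ z

  vertex-point : ∀ v → vertex (point v) ≡ v
  vertex-point (A i) = cong A (residue-toℕ n i)
  vertex-point (B i) = cong B (residue-toℕ n i)

  act : Element → RVertex n → RVertex n
  act x v = vertex (apply (classMap x) (point v))

  act-∙ : ∀ x y v → act x (act y v) ≡ act (x ∙ y) v
  act-∙ x y v = begin
    vertex (apply (classMap x) (point (vertex (apply (classMap y) (point v)))))
      ≡⟨ vertex-cong (apply-cong (classMap x) (point-vertex _)) ⟩
    vertex (apply (classMap x) (apply (classMap y) (point v)))
      ≡⟨ cong vertex (apply-⊙ (classMap x) (classMap y) (point v)) ⟩
    vertex (apply (classMap x ⊙ classMap y) (point v))
      ≡⟨ vertex-cong (apply-≃ (classMap x ⊙ classMap y) (classMap (x ∙ y)) (point v)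
                                (classMap-∙ x y (classOf (point v)))) ⟩
    vertex (apply (classMap (x ∙ y)) (point v)) ∎
    where open ≡-Reasoning

  identity-shift : ∀ c κ → ⟦ offset (table identity c) ⊕ sixfold κ ⟧ ≡ ⟦ sixfold κ ⟧
  identity-shift c κ = begin
    ⟦ offset (table identity c) ⊕ sixfold κ ⟧ ≡⟨ cong (λ μ → ⟦ offset μ ⊕ sixfold κ ⟧) (table-identity c) ⟩
    ⟦ (+ 0 , + 0) ⊕ sixfold κ ⟧               ≡⟨ ⟦⟧-⊕ (+ 0 , + 0) (sixfold κ) ⟩
    + 0 + ⟦ sixfold κ ⟧                       ≡⟨ ℤₚ.+-identityˡ _ ⟩
    ⟦ sixfold κ ⟧                             ∎
    where open ≡-Reasoning

  translate-fixes : ∀ κ → + n ∣ ⟦ sixfold κ ⟧ → ∀ p → apply (classMap (identity , κ)) p ~ p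
  translate-fixes κ n∣ (t , z) =
    cong side (table-identity c) , ≈-translate (subst (+ n ∣_) (sym (identity-shift c κ)) n∣)
    where c = t , residue 3 z

  act-trivial : ∀ b κ → b ≡ identity → + n ∣ ⟦ sixfold κ ⟧ → ∀ v → act (b , κ) v ≡ v
  act-trivial .identity κ refl n∣ v = trans (vertex-cong (translate-fixes κ n∣ (point v))) (vertex-point v)

  act-⁻¹ : ∀ x v → act (x ⁻¹) (act x v) ≡ v
  act-⁻¹ x@(b , κ) v =
    trans (act-∙ (x ⁻¹) x v) (act-trivial (inverse b · b) _ (proj₂ (table-inverse b)) n∣0 v)
    where
    J = correction (inverse b) b
    vanish : ∀ κ₁ κ₂ J₁ J₂ w →
      + 6 * (((- (κ₁ + J₁)) + κ₁) + J₁) * w + + 6 * (((- (κ₂ + J₂)) + κ₂) + J₂) ≡ + 0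
    vanish = solve-∀
    n∣0 : + n ∣ ⟦ sixfold (⊝ (κ ⊕ J) ⊕ κ ⊕ J) ⟧
    n∣0 = subst (+ n ∣_) (sym (vanish (proj₁ κ) (proj₂ κ) (proj₁ J) (proj₂ J) (+ W))) (divides (+ 0) refl)

  6∣⟦⊕sixfold⟧⇒6∣β : ∀ o κ → + 6 ∣ ⟦ o ⊕ sixfold κ ⟧ → + 6 ∣ proj₂ o
  6∣⟦⊕sixfold⟧⇒6∣β (α , β) (κ₁ , κ₂) 6∣ =
    subst (+ 6 ∣_) (isolate α β κ₁ κ₂ (+ W)) (∣m∣n⇒∣m-n 6∣ (∣n⇒∣m*n ((α + κ₁) * + W + κ₂) ∣-refl))
    where
    isolate : ∀ α β κ₁ κ₂ w → (+ 6 * (α + κ₁) * w + (β + + 6 * κ₂)) - ((α + κ₁) * w + κ₂) * + 6 ≡ β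
    isolate = solve-∀

  free : ∀ x u → act x u ≡ u → ∀ v → act x v ≡ v
  free x@(b , κ) u xu≡u = act-trivial b κ b≡identity n∣⟦κ⟧
    where
    c = classOf (point u)
    fixed : apply (classMap x) (point u) ~ point u
    fixed = ~-trans (~-sym (point-vertex _)) (subst (λ w → point w ~ point u) (sym xu≡u) ~-refl)
    n∣shift : + n ∣ ⟦ offset (table b c) ⊕ sixfold κ ⟧
    n∣shift = ≈-translate⁻¹ (proj₂ fixed)
    b≡identity : b ≡ identity
    b≡identity = table-free b c (proj₁ fixed)
                   (6∣⟦⊕sixfold⟧⇒6∣β (offset (table b c)) κ (∣-trans 6∣n n∣shift))
    n∣⟦κ⟧ : + n ∣ ⟦ sixfold κ ⟧
    n∣⟦κ⟧ = subst (+ n ∣_) (identity-shift c κ)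
              (subst (λ b → + n ∣ ⟦ offset (table b c) ⊕ sixfold κ ⟧) b≡identity n∣shift)

  origin : RVertex n
  origin = A zero

  reach : RVertex n → Element
  reach v = (t , residue 6 z) , (+ 0 , z /ℕ 6)
    where
    t = proj₁ (point v)
    z = proj₂ (point v)

  act-reach : ∀ v → act (reach v) origin ≡ v
  act-reach v = trans (cong vertex reach-point) (vertex-point v)
    where
    open ≡-Reasoning
    t = proj₁ (point v)
    z = proj₂ (point v)
    b   = t , residue 6 z
    z%6 = + toℕ (residue 6 z)
    z/6 = z /ℕ 6
    reassemble : ∀ r q w → + 0 + (+ 6 * (+ 0 + + 0) * w + (r + + 6 * q)) ≡ r + q * + 6
    reassemble = solve-∀
    reach-point : apply (classMap (reach v)) (point origin) ≡ point v
    reach-point = begin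
      side (table b base) , + 0 + ⟦ offset (table b base) ⊕ (+ 0 , + 6 * z/6) ⟧
        ≡⟨ cong (λ μ → side μ , + 0 + ⟦ offset μ ⊕ (+ 0 , + 6 * z/6) ⟧) (table-base b) ⟩
      t , + 0 + ⟦ (+ 0 , z%6) ⊕ (+ 0 , + 6 * z/6) ⟧
        ≡⟨ cong (t ,_) (trans (reassemble z%6 z/6 (+ W)) (sym (residue-decomposition 6 z))) ⟩
      point v ∎

  PointAdj : Point → Point → Set
  PointAdj (s , x) (t , y) = Σ (Dart s t) λ d → y ≈ x + ⟦ step d ⟧

  PointAdj-resp : ∀ {p p′ q q′} → p ~ p′ → q ~ q′ → PointAdj p q → PointAdj p′ q′
  PointAdj-resp {s , x} {.s , x′} {t , y} {.t , y′} (refl , x≈x′) (refl , y≈y′) (d , y≈x+d) =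
    d , ≈-trans (≈-sym y≈y′) (≈-trans y≈x+d (≈-+ʳ ⟦ step d ⟧ x≈x′))

  apply-PointAdj : ∀ x {p q} → PointAdj p q → PointAdj (apply (classMap x) p) (apply (classMap x) q)
  apply-PointAdj (b , κ) {s , x} {t , y} (d , y≈x+d) =
    subst (PointAdj (apply f (s , x))) (cong (λ ρ → side (f (t , ρ)) , y + ⟦ offset (f (t , ρ)) ⟧) (sym class-y))
          (d′ , shift-≈)
    where
    f  = classMap (b , κ)
    ρ  = residue 3 x
    ρ′ = next ρ (proj₂ (step d))
    class-y : residue 3 y ≡ ρ′
    class-y = trans (residue-cong 3 {y} {x + ⟦ step d ⟧} (≈⇒∣ 3∣n y≈x+d))
                    (residue-shift x (proj₁ (step d)) (proj₂ (step d)))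
    d′ = proj₁ (table-dart b d ρ)
    oₛ = offset (table b (s , ρ))
    oₜ = offset (table b (t , ρ′))
    D  = ⟦ step d ⟧
    D′ = ⟦ step d′ ⟧
    S  = ⟦ oₛ ⟧
    T  = ⟦ oₜ ⟧
    K  = ⟦ sixfold κ ⟧
    linear : ⟦ step d ⊕ oₜ ⊖ oₛ ⊖ step d′ ⟧ ≡ ((D + T) - S) - D′
    linear = trans (⟦⟧-⊖ (step d ⊕ oₜ ⊖ oₛ) (step d′))
               (cong (_- D′) (trans (⟦⟧-⊖ (step d ⊕ oₜ) oₛ) (cong (_- S) (⟦⟧-⊕ (step d) oₜ))))
    n∣ : + n ∣ ((D + T) - S) - D′
    n∣ = subst (+ n ∣_) linear (period⇒∣ (step d ⊕ oₜ ⊖ oₛ ⊖ step d′) (proj₂ (table-dart b d ρ)))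
    rearrange : ∀ x y D T S D′ K → (y - (x + D)) + (((D + T) - S) - D′) ≡ (y + (T + K)) - ((x + (S + K)) + D′)
    rearrange = solve-∀
    shift-≈ : y + ⟦ oₜ ⊕ sixfold κ ⟧ ≈ (x + ⟦ oₛ ⊕ sixfold κ ⟧) + D′
    shift-≈ = subst₂ (λ a c → y + a ≈ (x + c) + D′) (sym (⟦⟧-⊕ oₜ (sixfold κ))) (sym (⟦⟧-⊕ oₛ (sixfold κ)))
      (≈-by (∣m∣n⇒∣m+n (n∣x-y y≈x+d) n∣) (rearrange x y D T S D′ K))

  -a≡⟦AB⁻⟧ : - + a ≡ ⟦ step AB⁻ ⟧
  -a≡⟦AB⁻⟧ = trans (cong -_ a≡⟦BA⁺⟧) (sym (⟦⟧-⊝ (step BA⁺)))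

  -r≡⟦BB⁻⟧ : - + r ≡ ⟦ step BB⁻ ⟧
  -r≡⟦BB⁻⟧ = trans (cong -_ r≡⟦BB⁺⟧) (sym (⟦⟧-⊝ (step BB⁺)))

  Adj⇒PointAdj : ∀ u v → Graph.Adj Γ u v → PointAdj (point u) (point v)
  Adj⇒PointAdj (A i) (A j) (inj₁ j≡i+1)        = AA⁺ , [mod]⇒≈  (toℕ j) (toℕ i) 1 refl j≡i+1
  Adj⇒PointAdj (A i) (A j) (inj₂ i≡j+1)        = AA⁻ , [mod]⇒≈⁻ (toℕ i) (toℕ j) 1 refl i≡j+1
  Adj⇒PointAdj (A i) (B j) (inj₁ (inj₁ i≡j))   = AB  , [mod]⇒≈⁻ (toℕ i) (toℕ j) 0 refl ([mod]-+0 (toℕ i) (toℕ j) i≡j)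
  Adj⇒PointAdj (A i) (B j) (inj₁ (inj₂ i≡j+a)) = AB⁻ , [mod]⇒≈⁻ (toℕ i) (toℕ j) a -a≡⟦AB⁻⟧ i≡j+a
  Adj⇒PointAdj (A i) (B j) (inj₂ ())
  Adj⇒PointAdj (B i) (A j) (inj₁ ())
  Adj⇒PointAdj (B i) (A j) (inj₂ (inj₁ j≡i))   = BA  , [mod]⇒≈  (toℕ j) (toℕ i) 0 refl ([mod]-+0 (toℕ j) (toℕ i) j≡i)
  Adj⇒PointAdj (B i) (A j) (inj₂ (inj₂ j≡i+a)) = BA⁺ , [mod]⇒≈  (toℕ j) (toℕ i) a a≡⟦BA⁺⟧ j≡i+a
  Adj⇒PointAdj (B i) (B j) (inj₁ j≡i+r)        = BB⁺ , [mod]⇒≈  (toℕ j) (toℕ i) r r≡⟦BB⁺⟧ j≡i+r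
  Adj⇒PointAdj (B i) (B j) (inj₂ i≡j+r)        = BB⁻ , [mod]⇒≈⁻ (toℕ i) (toℕ j) r -r≡⟦BB⁻⟧ i≡j+r

  PointAdj⇒Adj : ∀ u v → PointAdj (point u) (point v) → Graph.Adj Γ u v
  PointAdj⇒Adj (A i) (A j) (AA⁺ , j≈i+1) = inj₁ (≈⇒[mod]  (toℕ j) (toℕ i) 1 refl j≈i+1)
  PointAdj⇒Adj (A i) (A j) (AA⁻ , j≈i-1) = inj₂ (≈⇒[mod]⁻ (toℕ i) (toℕ j) 1 refl j≈i-1)
  PointAdj⇒Adj (A i) (B j) (AB  , j≈i)   = inj₁ (inj₁ ([mod]-+0⁻¹ (toℕ i) (toℕ j) (≈⇒[mod]⁻ (toℕ i) (toℕ j) 0 refl j≈i)))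
  PointAdj⇒Adj (A i) (B j) (AB⁻ , j≈i-a) = inj₁ (inj₂ (≈⇒[mod]⁻ (toℕ i) (toℕ j) a -a≡⟦AB⁻⟧ j≈i-a))
  PointAdj⇒Adj (B i) (A j) (BA  , j≈i)   = inj₂ (inj₁ ([mod]-+0⁻¹ (toℕ j) (toℕ i) (≈⇒[mod] (toℕ j) (toℕ i) 0 refl j≈i)))
  PointAdj⇒Adj (B i) (A j) (BA⁺ , j≈i+a) = inj₂ (inj₂ (≈⇒[mod]  (toℕ j) (toℕ i) a a≡⟦BA⁺⟧ j≈i+a))
  PointAdj⇒Adj (B i) (B j) (BB⁺ , j≈i+r) = inj₁ (≈⇒[mod]  (toℕ j) (toℕ i) r r≡⟦BB⁺⟧ j≈i+r)
  PointAdj⇒Adj (B i) (B j) (BB⁻ , j≈i-r) = inj₂ (≈⇒[mod]⁻ (toℕ i) (toℕ j) r -r≡⟦BB⁻⟧ j≈i-r)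

  act-Adj : ∀ x u v → Graph.Adj Γ u v → Graph.Adj Γ (act x u) (act x v)
  act-Adj x u v u∼v = PointAdj⇒Adj (act x u) (act x v)
    (PointAdj-resp (~-sym (point-vertex (apply (classMap x) (point u))))
                   (~-sym (point-vertex (apply (classMap x) (point v))))
                   (apply-PointAdj x {point u} {point v} (Adj⇒PointAdj u v u∼v)))

  regularAction : RegularAction Γ
  regularAction = record
    { Carrier   = Element
    ; ε         = ε
    ; _∙_       = _∙_
    ; _⁻¹       = _⁻¹
    ; act       = act
    ; act-ε     = act-trivial identity (+ 0 , + 0) refl (divides (+ 0) refl)
    ; act-∙     = act-∙
    ; act-⁻¹    = act-⁻¹
    ; act-Adj   = act-Adj
    ; origin    = origin
    ; reach     = reach
    ; act-reach = act-reach
    ; free      = free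
    }

odd⇒≡1+2*[m/2] : ∀ m → m ℕ.% 2 ≡ 1 → m ≡ suc (2 ℕ.* (m ℕ./ 2))
odd⇒≡1+2*[m/2] m m-odd = trans (m≡m%n+[m/n]*n m 2) (cong₂ ℕ._+_ m-odd (ℕₚ.*-comm (m ℕ./ 2) 2))

-- The construction works for every odd m.
mainTheorem11 : (m : ℕ) → m ℕ.% 2 ≡ 1 → m ≢ 3 →
    IsCayley (RoseWindow (12 ℕ.* m) (3 ℕ.* m ℕ.+ 2) (9 ℕ.* m ℕ.+ 1))
mainTheorem11 m m-odd _ =
  subst (λ k → IsCayley (RoseWindow (12 ℕ.* k) (3 ℕ.* k ℕ.+ 2) (9 ℕ.* k ℕ.+ 1)))
        (sym (odd⇒≡1+2*[m/2] m m-odd))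
        (regularAction⇒Cayley (R₁₂ₘ.regularAction (m ℕ./ 2)))
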